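{- Let $X,Y\in\mathbb{Z}^n$, $S_1=X+\Upsilon_n$ and $S_2=Y+\Upsilon_n$. Then $S_1\cap S_2=\emptyset$ if and only if $d_C(X,Y)\ge3$.
   Context: $\Upsilon_n=\{U\in\mathbb{Z}^n:\sum_i|x_i-u_i|\le1\text{ for some }X\in\{ -1,0\}^n\}$ (a set of $2^n(n+1)$ points of $\mathbb{Z}^n$). The cross distance between $X=(x_1,\dots,x_n)$ and $Y=(y_1,\dots,y_n)$ in $\mathbb{Z}^n$ is $d_C(X,Y)=\sum_{i=1}^n\max\{0,|y_i-x_i|-1\}$. -}

module Defs where

open import Data.Nat using (ℕ)
open import Data.Integer using (ℤ; +_; -[1+_]; _-_; ∣_∣; _⊖_)
import Data.Nat as ℕ
open import Data.Vec using (Vec; []; _∷_; zipWith)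
open import Data.Product using (Σ; ∃; _×_)
open import Data.Sum using (_⊎_)
open import Relation.Binary.PropositionalEquality using (_≡_)

l1 : ∀ {n} → Vec ℤ n → Vec ℤ n → ℕ
l1 [] [] = 0
l1 (x ∷ xs) (u ∷ us) = ∣ x - u ∣ ℕ.+ l1 xs us

MinusOneOrZero : ℤ → Set
MinusOneOrZero x = (x ≡ -[1+ 0 ]) ⊎ (x ≡ + 0)

data InCube : ∀ {n} → Vec ℤ n → Set where
  []  : InCube []
  _∷_ : ∀ {n x} {xs : Vec ℤ n} → MinusOneOrZero x → InCube xs → InCube (x ∷ xs)

Upsilon : (n : ℕ) → Vec ℤ n → Set
Upsilon n U = ∃ λ (X : Vec ℤ n) → InCube X × (l1 X U ℕ.≤ 1)

TranslateUpsilon : (n : ℕ) → Vec ℤ n → Vec ℤ n → Set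
TranslateUpsilon n A Z = Upsilon n (zipWith _-_ Z A)

-- cross distance  d_C(X,Y) = Σ max{0, |y_i - x_i| - 1}  (natural subtraction = max{0, · - 1})
crossDist : ∀ {n} → Vec ℤ n → Vec ℤ n → ℕ
crossDist [] [] = 0
crossDist (x ∷ xs) (y ∷ ys) = (∣ y - x ∣ ℕ.∸ 1) ℕ.+ crossDist xs ys

module Submission where

-- The set X + Υ_n is the set of points at ℓ¹-distance ≤ 1 from the unit
-- cube X + {-1,0}^n.  The theorem is the case r = s = 1 of a metric fact:
--
--   some Z is within ℓ¹-distance r of X + {-1,0}^n and within s of
--   Y + {-1,0}^n   iff   d_C(X,Y) ≤ r + s.
--
-- It rests on two properties.  First, d_C(X,Y) is the ℓ¹-distance between
-- the two cubes: it is a lower bound for the distance of any pair of their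
-- points (cube-lower) and is attained by some pair (cube-attain); both are
-- proved coordinatewise.  Second, ℓ¹-distance on ℤ^n is geodesic: if
-- ‖P - Q‖₁ ≤ a + b there is a Z with ‖P - Z‖₁ ≤ a and ‖Z - Q‖₁ ≤ b
-- (l1-geodesic, from a splitting lemma for integers).  The triangle
-- inequality gives "only if", the geodesic property gives "if", and the
-- theorem follows since d_C(X,Y) ≥ 3 is the negation of d_C(X,Y) ≤ 2.

open import Defs
open import Data.Nat using (ℕ; _≥_)
open import Data.Integer using (ℤ)
open import Data.Vec using (Vec)
open import Data.Product using (∃; _×_)
open import Relation.Nullary using (¬_)
open import Function.Bundles using (_⇔_)

open import Data.Nat as N using (zero; suc; z≤n; s≤s; _≤_; _∸_)
import Data.Nat.Properties as NP
open import Data.Integer as Z using (+_; -[1+_]; _-_)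
import Data.Integer.Properties as ZP
open import Data.Integer.Tactic.RingSolver using (solve-∀)
open import Data.Vec using ([]; _∷_; zipWith)
open import Data.Product using (∃₂; _,_)
open import Data.Sum using (inj₁; inj₂)
open import Relation.Nullary using (yes; no; contradiction)
open import Relation.Binary.PropositionalEquality
open import Function.Bundles using (mk⇔; Equivalence)
open import Algebra.Properties.CommutativeSemigroup NP.+-commutativeSemigroup
  using (interchange)

-- Coordinatewise sum of integer vectors: A ⊕ C is the point of the cube
-- A + {-1,0}^n with offset C.
_⊕_ : ∀ {n} → Vec ℤ n → Vec ℤ n → Vec ℤ n
_⊕_ = zipWith Z._+_

-- Points at ℓ¹-distance ≤ r from the cube A + {-1,0}^n; for r = 1 this is
-- A + Υ_n, i.e. TranslateUpsilon n A.
CubeNbhd : (n r : ℕ) → Vec ℤ n → Vec ℤ n → Set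
CubeNbhd n r A Z = ∃ λ (C : Vec ℤ n) → InCube C × (l1 C (zipWith _-_ Z A) ≤ r)

ℕ-split : ∀ {k} a b → k ≤ a N.+ b →
  ∃₂ λ k₁ k₂ → k ≡ k₁ N.+ k₂ × k₁ ≤ a × k₂ ≤ b
ℕ-split {k} a b k≤a+b with k N.≤? a
... | yes k≤a = k , 0 , sym (NP.+-identityʳ k) , k≤a , z≤n
... | no  k≰a = a , k ∸ a , sym (NP.m+[n∸m]≡n (NP.<⇒≤ (NP.≰⇒> k≰a)))
              , NP.≤-refl , NP.m≤n+o⇒m∸n≤o k a k≤a+b

ℤ-split : ∀ d a b → Z.∣ d ∣ ≤ a N.+ b →
  ∃₂ λ d₁ d₂ → d ≡ d₁ Z.+ d₂ × Z.∣ d₁ ∣ ≤ a × Z.∣ d₂ ∣ ≤ b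
ℤ-split (+ k) a b h with ℕ-split a b h
... | k₁ , k₂ , refl , h₁ , h₂ = + k₁ , + k₂ , ZP.pos-+ k₁ k₂ , h₁ , h₂
ℤ-split -[1+ k ] a b h with ℕ-split a b h
... | k₁ , k₂ , e , h₁ , h₂ =
  Z.- + k₁ , Z.- + k₂ , negative , subst (_≤ a) (sym (ZP.∣-i∣≡∣i∣ (+ k₁))) h₁
                                 , subst (_≤ b) (sym (ZP.∣-i∣≡∣i∣ (+ k₂))) h₂
  where
  negative : -[1+ k ] ≡ Z.- + k₁ Z.+ Z.- + k₂
  negative = begin
    Z.- + suc k            ≡⟨ cong (λ m → Z.- + m) e ⟩
    Z.- + (k₁ N.+ k₂)      ≡⟨ cong Z.-_ (ZP.pos-+ k₁ k₂) ⟩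
    Z.- (+ k₁ Z.+ + k₂)    ≡⟨ ZP.neg-distrib-+ (+ k₁) (+ k₂) ⟩
    Z.- + k₁ Z.+ Z.- + k₂  ∎
    where open ≡-Reasoning

ℤ-geodesic : ∀ p q a b → Z.∣ p - q ∣ ≤ a N.+ b →
  ∃ λ z → Z.∣ p - z ∣ ≤ a × Z.∣ z - q ∣ ≤ b
ℤ-geodesic p q a b h with ℤ-split (p - q) a b h
... | d₁ , d₂ , e , h₁ , h₂ =
  p - d₁ , subst (λ w → Z.∣ w ∣ ≤ a) (sym (back p d₁)) h₁
         , subst (λ w → Z.∣ w ∣ ≤ b) (sym rest) h₂
  where
  back : ∀ p d → p - (p - d) ≡ d
  back = solve-∀
  shift : ∀ p q d → (p - d) - q ≡ (p - q) - d
  shift = solve-∀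
  cancel : ∀ d₁ d₂ → (d₁ Z.+ d₂) - d₁ ≡ d₂
  cancel = solve-∀
  rest : (p - d₁) - q ≡ d₂
  rest = trans (shift p q d₁) (trans (cong (_- d₁) e) (cancel d₁ d₂))

-- Budget bookkeeping for the vector geodesic: once the first coordinate
-- has used u₁ ≤ a and u₂ ≤ b, the remaining budgets still cover the rest.
remaining-budget : ∀ {u₁ u₂ v a b} → u₁ ≤ a → u₂ ≤ b →
  (u₁ N.+ u₂) N.+ v ≤ a N.+ b → v ≤ (a ∸ u₁) N.+ (b ∸ u₂)
remaining-budget {u₁} {u₂} {v} {a} {b} u₁≤a u₂≤b h =
  NP.+-cancelˡ-≤ (u₁ N.+ u₂) v _ (subst ((u₁ N.+ u₂) N.+ v ≤_) a+b-split h)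
  where
  a+b-split : a N.+ b ≡ (u₁ N.+ u₂) N.+ ((a ∸ u₁) N.+ (b ∸ u₂))
  a+b-split = trans (sym (cong₂ N._+_ (NP.m+[n∸m]≡n u₁≤a) (NP.m+[n∸m]≡n u₂≤b)))
                    (interchange u₁ (a ∸ u₁) u₂ (b ∸ u₂))

l1-geodesic : ∀ {n} (P Q : Vec ℤ n) a b → l1 P Q ≤ a N.+ b →
  ∃ λ Z → l1 P Z ≤ a × l1 Z Q ≤ b
l1-geodesic [] [] a b h = [] , z≤n , z≤n
l1-geodesic (p ∷ P) (q ∷ Q) a b h
  with ℕ-split a b (NP.m+n≤o⇒m≤o Z.∣ p - q ∣ h)
... | u₁ , u₂ , e , u₁≤a , u₂≤b
  with ℤ-geodesic p q u₁ u₂ (NP.≤-reflexive e)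
     | l1-geodesic P Q (a ∸ u₁) (b ∸ u₂)
         (remaining-budget u₁≤a u₂≤b (subst (λ u → u N.+ l1 P Q ≤ a N.+ b) e h))
... | z , hp , hq | Zs , hP , hQ =
  z ∷ Zs , within u₁≤a hp hP , within u₂≤b hq hQ
  where
  within : ∀ {u c x y} → u ≤ c → x ≤ u → y ≤ c ∸ u → x N.+ y ≤ c
  within u≤c x≤u y≤c∸u =
    NP.≤-trans (NP.+-mono-≤ x≤u y≤c∸u) (NP.≤-reflexive (NP.m+[n∸m]≡n u≤c))

l1-sym : ∀ {n} (P Q : Vec ℤ n) → l1 P Q ≡ l1 Q P
l1-sym [] [] = refl
l1-sym (p ∷ P) (q ∷ Q) = cong₂ N._+_ (ZP.∣i-j∣≡∣j-i∣ p q) (l1-sym P Q)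

l1-triangle : ∀ {n} (P Z Q : Vec ℤ n) → l1 P Q ≤ l1 P Z N.+ l1 Z Q
l1-triangle [] [] [] = z≤n
l1-triangle (p ∷ P) (z ∷ Zs) (q ∷ Q) =
  NP.≤-trans (NP.+-mono-≤ coord (l1-triangle P Zs Q))
             (NP.≤-reflexive (interchange Z.∣ p - z ∣ Z.∣ z - q ∣ (l1 P Zs) (l1 Zs Q)))
  where
  through : ∀ p z q → p - q ≡ (p - z) Z.+ (z - q)
  through = solve-∀
  coord : Z.∣ p - q ∣ ≤ Z.∣ p - z ∣ N.+ Z.∣ z - q ∣
  coord = subst (λ w → Z.∣ w ∣ ≤ Z.∣ p - z ∣ N.+ Z.∣ z - q ∣) (sym (through p z q))
                (ZP.∣i+j∣≤∣i∣+∣j∣ (p - z) (z - q))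

l1-offset : ∀ {n} (C Z A : Vec ℤ n) → l1 C (zipWith _-_ Z A) ≡ l1 (A ⊕ C) Z
l1-offset [] [] [] = refl
l1-offset (c ∷ C) (z ∷ Zs) (a ∷ A) = cong₂ N._+_ (cong Z.∣_∣ (offset c z a)) (l1-offset C Zs A)
  where
  offset : ∀ c z a → c - (z - a) ≡ (a Z.+ c) - z
  offset = solve-∀

offset-gap : ∀ {c₁ c₂} → MinusOneOrZero c₁ → MinusOneOrZero c₂ → Z.∣ c₁ - c₂ ∣ ≤ 1
offset-gap (inj₁ refl) (inj₁ refl) = z≤n
offset-gap (inj₁ refl) (inj₂ refl) = s≤s z≤n
offset-gap (inj₂ refl) (inj₁ refl) = s≤s z≤n
offset-gap (inj₂ refl) (inj₂ refl) = z≤n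

coord-lower : ∀ x y {c₁ c₂} → MinusOneOrZero c₁ → MinusOneOrZero c₂ →
  Z.∣ y - x ∣ ∸ 1 ≤ Z.∣ (x Z.+ c₁) - (y Z.+ c₂) ∣
coord-lower x y {c₁} {c₂} m₁ m₂ = NP.m≤n+o⇒m∸n≤o _ 1 (begin
  Z.∣ y - x ∣                                  ≡⟨ cong Z.∣_∣ (decompose x y c₁ c₂) ⟩
  Z.∣ (c₁ - c₂) - ((x Z.+ c₁) - (y Z.+ c₂)) ∣  ≤⟨ ZP.∣i-j∣≤∣i∣+∣j∣ (c₁ - c₂) _ ⟩
  Z.∣ c₁ - c₂ ∣ N.+ Z.∣ (x Z.+ c₁) - (y Z.+ c₂) ∣
                                               ≤⟨ NP.+-monoˡ-≤ _ (offset-gap m₁ m₂) ⟩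
  1 N.+ Z.∣ (x Z.+ c₁) - (y Z.+ c₂) ∣          ∎)
  where
  open NP.≤-Reasoning
  decompose : ∀ x y c₁ c₂ → y - x ≡ (c₁ - c₂) - ((x Z.+ c₁) - (y Z.+ c₂))
  decompose = solve-∀

shrink : ∀ d → ∃₂ λ c₁ c₂ → MinusOneOrZero c₁ × MinusOneOrZero c₂ ×
  (Z.∣ (c₁ - c₂) - d ∣ ≡ Z.∣ d ∣ ∸ 1)
shrink (+ zero)  = + 0 , + 0 , inj₂ refl , inj₂ refl , refl
shrink (+ suc k) = + 0 , -[1+ 0 ] , inj₂ refl , inj₁ refl , ZP.∣⊖∣-≤ {1} (s≤s z≤n)
shrink -[1+ k ]  = -[1+ 0 ] , + 0 , inj₁ refl , inj₂ refl , refl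

coord-attain : ∀ x y → ∃₂ λ c₁ c₂ → MinusOneOrZero c₁ × MinusOneOrZero c₂ ×
  (Z.∣ (x Z.+ c₁) - (y Z.+ c₂) ∣ ≡ Z.∣ y - x ∣ ∸ 1)
coord-attain x y with shrink (y - x)
... | c₁ , c₂ , m₁ , m₂ , e = c₁ , c₂ , m₁ , m₂ , trans (cong Z.∣_∣ (regroup x y c₁ c₂)) e
  where
  regroup : ∀ x y c₁ c₂ → (x Z.+ c₁) - (y Z.+ c₂) ≡ (c₁ - c₂) - (y - x)
  regroup = solve-∀

cube-lower : ∀ {n} (X Y : Vec ℤ n) {C₁ C₂ : Vec ℤ n} → InCube C₁ → InCube C₂ →
  crossDist X Y ≤ l1 (X ⊕ C₁) (Y ⊕ C₂)
cube-lower [] [] [] [] = z≤n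
cube-lower (x ∷ X) (y ∷ Y) (m₁ ∷ i₁) (m₂ ∷ i₂) =
  NP.+-mono-≤ (coord-lower x y m₁ m₂) (cube-lower X Y i₁ i₂)

cube-attain : ∀ {n} (X Y : Vec ℤ n) → ∃₂ λ (C₁ C₂ : Vec ℤ n) →
  InCube C₁ × InCube C₂ × l1 (X ⊕ C₁) (Y ⊕ C₂) ≡ crossDist X Y
cube-attain [] [] = [] , [] , [] , [] , refl
cube-attain (x ∷ X) (y ∷ Y) with coord-attain x y | cube-attain X Y
... | c₁ , c₂ , m₁ , m₂ , e | C₁ , C₂ , i₁ , i₂ , E =
  c₁ ∷ C₁ , c₂ ∷ C₂ , m₁ ∷ i₁ , m₂ ∷ i₂ , cong₂ N._+_ e E

common-nbhd⇔ : ∀ n r s (X Y : Vec ℤ n) →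
  (∃ λ Z → CubeNbhd n r X Z × CubeNbhd n s Y Z) ⇔ (crossDist X Y ≤ r N.+ s)
common-nbhd⇔ n r s X Y = mk⇔ meet⇒close close⇒meet
  where
  meet⇒close : (∃ λ Z → CubeNbhd n r X Z × CubeNbhd n s Y Z) → crossDist X Y ≤ r N.+ s
  meet⇒close (Z , (C₁ , i₁ , h₁) , (C₂ , i₂ , h₂)) = begin
    crossDist X Y                              ≤⟨ cube-lower X Y i₁ i₂ ⟩
    l1 (X ⊕ C₁) (Y ⊕ C₂)                       ≤⟨ l1-triangle (X ⊕ C₁) Z (Y ⊕ C₂) ⟩
    l1 (X ⊕ C₁) Z N.+ l1 Z (Y ⊕ C₂)            ≡⟨ cong (l1 (X ⊕ C₁) Z N.+_) (l1-sym Z (Y ⊕ C₂)) ⟩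
    l1 (X ⊕ C₁) Z N.+ l1 (Y ⊕ C₂) Z            ≡⟨ sym (cong₂ N._+_ (l1-offset C₁ Z X) (l1-offset C₂ Z Y)) ⟩
    l1 C₁ (zipWith _-_ Z X) N.+ l1 C₂ (zipWith _-_ Z Y) ≤⟨ NP.+-mono-≤ h₁ h₂ ⟩
    r N.+ s                                    ∎
    where open NP.≤-Reasoning
  close⇒meet : crossDist X Y ≤ r N.+ s → ∃ λ Z → CubeNbhd n r X Z × CubeNbhd n s Y Z
  close⇒meet h with cube-attain X Y
  ... | C₁ , C₂ , i₁ , i₂ , e
    with l1-geodesic (X ⊕ C₁) (Y ⊕ C₂) r s (subst (_≤ r N.+ s) (sym e) h)
  ... | Z , h₁ , h₂ =
    Z , (C₁ , i₁ , subst (_≤ r) (sym (l1-offset C₁ Z X)) h₁)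
      , (C₂ , i₂ , subst (_≤ s) (trans (l1-sym Z (Y ⊕ C₂)) (sym (l1-offset C₂ Z Y))) h₂)

theorem1 : (n : ℕ) (X Y : Vec ℤ n) →
    (¬ (∃ λ (Z : Vec ℤ n) → TranslateUpsilon n X Z × TranslateUpsilon n Y Z))
    ⇔ (crossDist X Y ≥ 3)
theorem1 n X Y = mk⇔ disjoint⇒far far⇒disjoint
  where
  open Equivalence (common-nbhd⇔ n 1 1 X Y) renaming (to to meet⇒close; from to close⇒meet)
  disjoint⇒far : ¬ (∃ λ Z → TranslateUpsilon n X Z × TranslateUpsilon n Y Z) → crossDist X Y ≥ 3
  disjoint⇒far disjoint with crossDist X Y N.≤? 2
  ... | yes close = contradiction (close⇒meet close) disjoint
  ... | no  far   = NP.≰⇒> far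
  far⇒disjoint : crossDist X Y ≥ 3 → ¬ (∃ λ Z → TranslateUpsilon n X Z × TranslateUpsilon n Y Z)
  far⇒disjoint far meet = NP.<⇒≱ far (meet⇒close meet)
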